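{- Let $\mathcal M(q)=(\mathcal P,\mathcal Z)$ be a finite Möbius plane of order $q$, let $G$ be its point-circle incidence graph with graph distance $d$, and let $H$ be the hypergraph with vertex set $\mathcal P\cup\mathcal Z$ whose hyperedges are the sets $e_{a,b}=\{v\in\mathcal P\cup\mathcal Z : d(v,a)\ne d(v,b)\}$ for all pairs of distinct circles $a,b\in\mathcal Z$. Then every hyperedge of $H$ has at least $\frac{q^3}{2}-3q^2+\frac{11q}{2}-1$ vertices.
   Context: A Möbius plane is a pair $(\mathcal P,\mathcal Z)$, where $\mathcal P$ is a set (of points) and $\mathcal Z$ is a set of subsets of $\mathcal P$ (circles), such that: (i) any three pairwise distinct points lie on exactly one circle; (ii) if $z\in\mathcal Z$, $P\in z$ and $Q\in\mathcal P\setminus z$, there is exactly one circle $z'$ through $P$ and $Q$ with $z\cap z'=\{P\}$; (iii) there is at least one circle and every circle has at least three points; (iv) for every circle $z$ there is a point not on $z$. It is finite if $\mathcal P$ is finite; then all circles have the same number $q+1$ of points, and $q$ is the order. The point-circle incidence graph has vertex set $\mathcal P\cup\mathcal Z$ and edges $\{P,z\}$ with $P\in z$; $d$ denotes the shortest-path distance in this graph. -}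

module Defs where

open import Data.Nat using (ℕ; zero; suc; _≤_; _≟_)
open import Data.Bool using (Bool; true; false; _∧_; _∨_; if_then_else_; not)
open import Data.Fin using (Fin)
import Data.Fin as F
open import Data.Sum using (_⊎_; inj₁; inj₂)
open import Data.List using (List; map; _++_; length; filterᵇ)
open import Data.Bool.ListAction using (any)
open import Data.List using (allFin)
open import Data.Product using (Σ; _×_; _,_)
open import Relation.Binary.PropositionalEquality using (_≡_; _≢_)
open import Relation.Nullary using (¬_)
open import Relation.Nullary.Decidable using (⌊_⌋)

-- An incidence structure with points Fin n and circles Fin m;
-- inc P z = true  means  P ∈ z.
Incidence : ℕ → ℕ → Set
Incidence n m = Fin n → Fin m → Bool

module _ {n m : ℕ} (inc : Incidence n m) where

  On : Fin n → Fin m → Set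
  On P z = inc P z ≡ true

  circleSize : Fin m → ℕ
  circleSize z = length (filterᵇ (λ P → inc P z) (allFin n))

  -- the axioms (i)-(iv) of a Möbius plane, plus: circles are subsets
  -- of the point set (distinct circle indices have distinct point sets)
  record IsMobiusPlane : Set where
    field
      circlesAreSets : ∀ (z z' : Fin m) → (∀ P → inc P z ≡ inc P z') → z ≡ z'
      axiom1 : ∀ (P Q R : Fin n) → P ≢ Q → P ≢ R → Q ≢ R →
               Σ (Fin m) λ z → (On P z × On Q z × On R z) ×
                 (∀ z' → On P z' → On Q z' → On R z' → z' ≡ z)
      axiom2 : ∀ (z : Fin m) (P Q : Fin n) → On P z → ¬ On Q z →
               Σ (Fin m) λ z' → (On P z' × On Q z' ×
                 (∀ X → On X z → On X z' → X ≡ P)) ×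
                 (∀ z'' → On P z'' → On Q z'' →
                    (∀ X → On X z → On X z'' → X ≡ P) → z'' ≡ z')
      axiom3a : Fin m
      axiom3b : ∀ (z : Fin m) → 3 ≤ circleSize z
      axiom4 : ∀ (z : Fin m) → Σ (Fin n) λ P → ¬ On P z

  Vertex : Set
  Vertex = Fin n ⊎ Fin m

  vertices : List Vertex
  vertices = map inj₁ (allFin n) ++ map inj₂ (allFin m)

  eqV : Vertex → Vertex → Bool
  eqV (inj₁ P) (inj₁ Q) = ⌊ P F.≟ Q ⌋
  eqV (inj₂ z) (inj₂ w) = ⌊ z F.≟ w ⌋
  eqV _ _ = false

  adj : Vertex → Vertex → Bool
  adj (inj₁ P) (inj₂ z) = inc P z
  adj (inj₂ z) (inj₁ P) = inc P z
  adj _ _ = false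

  reach : ℕ → Vertex → Vertex → Bool
  reach zero u v = eqV u v
  reach (suc k) u v = reach k u v ∨ any (λ w → reach k u w ∧ adj w v) vertices

  -- graph distance: least k with a walk of length ≤ k (search up to n+m,
  -- which exceeds every finite distance in a graph with n+m vertices)
  distSearch : ℕ → ℕ → Vertex → Vertex → ℕ
  distSearch k zero u v = k
  distSearch k (suc f) u v = if reach k u v then k else distSearch (suc k) f u v

  dist : Vertex → Vertex → ℕ
  dist u v = distSearch 0 (n Data.Nat.+ m) u v

  hyperedge : Fin m → Fin m → List Vertex
  hyperedge a b = filterᵇ (λ v → not ⌊ dist v (inj₂ a) ≟ dist v (inj₂ b) ⌋) vertices

-- A circle c ≠ a meeting a but missing b has d(c, a) = 2 < d(c, b), and a, b themselves
-- are separated by d(a, a) = 0 < d(a, b); with the roles of a and b swapped this gives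
-- |e_{a,b}| ≥ 2 + N(a, b) + N(b, a), where N(a, b) counts the circles c ≠ a that meet a
-- and miss b.  Double counting in M(q) gives q² + 1 points, q + 1 circles through two
-- points and q(q + 1) through one.  For a point P of a ∖ b, weighing the circles c
-- through P by 2 ≤ 2·[|c ∩ b| = 0] + [|c ∩ b| = 1] + |c ∩ b| shows that at least
-- (q + 1)(q − 2)/2 of them miss b.  Such a circle meets a in at most two points and
-- |a ∖ b| ≥ q − 1, so 4 N(a, b) ≥ (q − 1)(q² − q − 4), which is the bound.

module Submission where

open import Defs
open import Data.Bool using (Bool; true; false; _∧_; _∨_; not)
open import Data.Bool.ListAction using (any)
open import Data.Bool.Properties using (∧-zeroʳ; ∧-identityʳ; ∧-assoc; ∧-comm; ∧-idem; T-≡; ¬-not; not-¬)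
open import Data.Empty using (⊥; ⊥-elim)
open import Data.Fin using (Fin; zero; suc; _≟_)
open import Data.List using (List; []; _∷_; length; filterᵇ; tabulate; map; _++_; allFin)
open import Data.List.Membership.Propositional using (_∈_; lose)
open import Data.List.Membership.Propositional.Properties using (∈-++⁺ˡ; ∈-++⁺ʳ; ∈-map⁺; ∈-allFin)
open import Data.List.Properties using (map-tabulate; filter-++; length-++)
open import Data.List.Relation.Unary.Any.Properties using (any⁺)
open import Data.Nat using (ℕ; zero; suc; pred; _+_; _*_; _^_; _≤_; _<_; z≤n; s≤s; _≡ᵇ_; >-nonZero)
import Data.Nat as ℕ
open import Data.Nat.Properties hiding (_≟_)
open import Algebra.Properties.Semiring.Sum +-*-semiring
  using (sum; ∑-comm; ∑-distrib-+; *-distribˡ-sum; *-distribʳ-sum; sum-cong-≗; sum-replicate-zero)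
open import Data.Nat.Tactic.RingSolver using (solve-∀)
open import Data.Product using (∃; _,_; _×_; proj₁; proj₂)
open import Data.Sum using (_⊎_; inj₁; inj₂)
open import Function using (_∘_; id; Equivalence; case_of_)
open import Relation.Binary.PropositionalEquality
open import Relation.Nullary using (yes; no; ¬_; contradiction)
open import Relation.Nullary.Decidable using (⌊_⌋)

private variable
  k l : ℕ
  A : Set

-- Boolean tests and counting over Fin k

_==_ : Fin k → Fin k → Bool
x == y = ⌊ x ≟ y ⌋

==-refl : (x : Fin k) → x == x ≡ true
==-refl x with x ≟ x
... | yes _   = refl
... | no x≢x = ⊥-elim (x≢x refl)

==⇒≡ : {x y : Fin k} → x == y ≡ true → x ≡ y
==⇒≡ {x = x} {y} eq with x ≟ y
... | yes x≡y = x≡y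

≢⇒==-false : {x y : Fin k} → x ≢ y → x == y ≡ false
≢⇒==-false {x = x} {y} x≢y with x ≟ y
... | yes x≡y = ⊥-elim (x≢y x≡y)
... | no _    = refl

not-==⇒≢ : {x y : Fin k} → not (x == y) ≡ true → x ≢ y
not-==⇒≢ {x = x} h refl rewrite ==-refl x = case h of λ ()

suc-== : (x y : Fin k) → suc x == suc y ≡ x == y
suc-== x y with x ≟ y
... | yes _ = refl
... | no _  = refl

∧-intro : ∀ {a b} → a ≡ true → b ≡ true → a ∧ b ≡ true
∧-intro refl refl = refl

∧-elim : ∀ {a b} → a ∧ b ≡ true → a ≡ true × b ≡ true
∧-elim {true} {true} _ = refl , refl

∨-elim : ∀ {a b} → a ∨ b ≡ true → a ≡ true ⊎ b ≡ true
∨-elim {true}  _ = inj₁ refl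
∨-elim {false} h = inj₂ h

not≡true⇒≡false : ∀ {b} → not b ≡ true → b ≡ false
not≡true⇒≡false {false} _ = refl

≡ᵇ-true⇒≡ : ∀ {u v} → (u ≡ᵇ v) ≡ true → u ≡ v
≡ᵇ-true⇒≡ {u} {v} h = ≡ᵇ⇒≡ u v (Equivalence.from T-≡ h)

>0⇒≢ᵇ0 : ∀ {v} → 0 < v → (v ≡ᵇ 0) ≡ false
>0⇒≢ᵇ0 (s≤s _) = refl

≢ᵇ0⇒>0 : ∀ {v} → (v ≡ᵇ 0) ≡ false → 0 < v
≢ᵇ0⇒>0 {suc v} _ = s≤s z≤n

indicator : Bool → ℕ
indicator true  = 1
indicator false = 0

count : (Fin k → Bool) → ℕ
count p = sum (indicator ∘ p)

private variable
  p r : Fin k → Bool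

sum-mono : {f g : Fin k → ℕ} → (∀ x → f x ≤ g x) → sum f ≤ sum g
sum-mono {zero}  _   = z≤n
sum-mono {suc k} f≤g = +-mono-≤ (f≤g zero) (sum-mono (f≤g ∘ suc))

count-cong : (∀ x → p x ≡ r x) → count p ≡ count r
count-cong p≗r = sum-cong-≗ (cong indicator ∘ p≗r)

count-mono : (∀ x → p x ≡ true → r x ≡ true) → count p ≤ count r
count-mono {p = p} {r} p⇒r = sum-mono λ x → indicator-mono (p x) (r x) (p⇒r x)
  where
  indicator-mono : ∀ a b → (a ≡ true → b ≡ true) → indicator a ≤ indicator b
  indicator-mono false b _   = z≤n
  indicator-mono true  b a⇒b rewrite a⇒b refl = ≤-refl

count-false : (∀ x → p x ≡ false) → count p ≡ 0
count-false {k} p≗false = trans (count-cong p≗false) (sum-replicate-zero k)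

count-true : count {k} (λ _ → true) ≡ k
count-true {zero}  = refl
count-true {suc k} = cong suc (count-true {k})

count≡0⇒false : count p ≡ 0 → ∀ x → p x ≡ false
count≡0⇒false {suc k} {p} eq x with p zero in p0
count≡0⇒false {suc k} {p} eq zero    | false = p0
count≡0⇒false {suc k} {p} eq (suc x) | false = count≡0⇒false {p = p ∘ suc} eq x

count>0⇒∃ : 0 < count p → ∃ λ x → p x ≡ true
count>0⇒∃ {suc k} {p} pos with p zero in p0
... | true  = zero , p0
... | false = let x , px = count>0⇒∃ {p = p ∘ suc} pos in suc x , px

_without_ : (Fin k → Bool) → Fin k → (Fin k → Bool)
(p without x) y = p y ∧ not (y == x)

without⇒ : {x y : Fin k} → (p without x) y ≡ true → p y ≡ true × y ≢ x
without⇒ {p = p} {x} {y} h with p y | y ≟ x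
... | true | no y≢x = refl , y≢x

count-remove : (x : Fin k) → p x ≡ true → count p ≡ suc (count (p without x))
count-remove {suc k} {p} zero    px rewrite px =
  cong suc (count-cong {p = p ∘ suc} λ y → sym (∧-identityʳ (p (suc y))))
count-remove {suc k} {p} (suc x) px = begin
    indicator (p zero) + count (p ∘ suc)
  ≡⟨ cong (indicator (p zero) +_) (count-remove {p = p ∘ suc} x px) ⟩
    indicator (p zero) + suc (count ((p ∘ suc) without x))
  ≡⟨ +-suc (indicator (p zero)) _ ⟩
    suc (indicator (p zero) + count ((p ∘ suc) without x))
  ≡⟨ cong₂ (λ a c → suc (indicator a + c)) (sym (∧-identityʳ (p zero)))
           (count-cong λ y → cong (λ b → p (suc y) ∧ not b) (sym (suc-== y x))) ⟩
    suc (count (p without suc x))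
  ∎
  where open ≡-Reasoning

count-remove-≤ : (x : Fin k) → count p ≤ suc (count (p without x))
count-remove-≤ {p = p} x with p x in px
... | true  = ≤-reflexive (count-remove x px)
... | false = ≤-trans (count-mono keep) (n≤1+n _)
  where
  keep : ∀ y → p y ≡ true → (p without x) y ≡ true
  keep y py with y ≟ x
  ... | yes refl with () ← trans (sym py) px
  ... | no _ rewrite py = refl

count-≥1 : (x : Fin k) → p x ≡ true → 1 ≤ count p
count-≥1 x px = ≤-trans (s≤s z≤n) (≤-reflexive (sym (count-remove x px)))

count≡1 : (x : Fin k) → p x ≡ true → (∀ y → p y ≡ true → y ≡ x) → count p ≡ 1
count≡1 {p = p} x px unique = trans (count-remove x px) (cong suc (count-false others))
  where
  others : ∀ y → (p without x) y ≡ false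
  others y with p y in py
  ... | false = refl
  ... | true  rewrite unique y py | ==-refl x = refl

count≤1 : (∀ x y → p x ≡ true → p y ≡ true → x ≡ y) → count p ≤ 1
count≤1 {p = p} unique with count p in eq
... | zero  = z≤n
... | suc _ with count>0⇒∃ {p = p} (subst (0 <_) (sym eq) (s≤s z≤n))
...   | x , px = ≤-reflexive (trans (sym eq) (count≡1 x px λ y py → unique y x py px))

count≤2 : (∀ x y z → p x ≡ true → p y ≡ true → p z ≡ true → x ≢ y → x ≢ z → y ≢ z → ⊥) →
          count p ≤ 2
count≤2 {p = p} no-three with count p in eq
... | zero  = z≤n
... | suc _ with count>0⇒∃ {p = p} (subst (0 <_) (sym eq) (s≤s z≤n))
...   | x , px = ≤-trans (≤-reflexive (trans (sym eq) (count-remove x px))) (s≤s (count≤1 at-most-one))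
  where
  at-most-one : ∀ y z → (p without x) y ≡ true → (p without x) z ≡ true → y ≡ z
  at-most-one y z hy hz with y ≟ z | without⇒ {p = p} hy | without⇒ {p = p} hz
  ... | yes y≡z | _ | _ = y≡z
  ... | no y≢z | py , y≢x | pz , z≢x = ⊥-elim (no-three x y z px py pz (y≢x ∘ sym) (z≢x ∘ sym) y≢z)

count≡1⇒unique : count p ≡ 1 → ∀ x y → p x ≡ true → p y ≡ true → x ≡ y
count≡1⇒unique {p = p} eq x y px py with y ≟ x
... | yes y≡x = sym y≡x
... | no y≢x  = contradiction (trans (sym (count≡0⇒false rest≡0 y)) y-remains) λ ()
  where
  rest≡0 : count (p without x) ≡ 0
  rest≡0 = suc-injective (trans (sym (count-remove x px)) eq)
  y-remains : (p without x) y ≡ true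
  y-remains rewrite py | ≢⇒==-false y≢x = refl

count-split : (p r : Fin k → Bool) →
              count p ≡ count (λ x → p x ∧ r x) + count (λ x → p x ∧ not (r x))
count-split p r = trans (sum-cong-≗ λ x → split (p x) (r x))
  (∑-distrib-+ (λ x → indicator (p x ∧ r x)) (λ x → indicator (p x ∧ not (r x))))
  where
  split : ∀ a b → indicator a ≡ indicator (a ∧ b) + indicator (a ∧ not b)
  split true  true  = refl
  split true  false = refl
  split false _     = refl

count-∨ : (∀ x → p x ≡ true → r x ≡ true → ⊥) →
          count (λ x → p x ∨ r x) ≡ count p + count r
count-∨ {p = p} {r} disjoint = trans (sum-cong-≗ λ x → split (p x) (r x) (disjoint x))
  (∑-distrib-+ (indicator ∘ p) (indicator ∘ r))
  where
  split : ∀ a b → (a ≡ true → b ≡ true → ⊥) → indicator (a ∨ b) ≡ indicator a + indicator b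
  split true  true  both = ⊥-elim (both refl refl)
  split true  false _    = refl
  split false _     _    = refl

count-guard : (b : Bool) (r : Fin k → Bool) → count (λ y → b ∧ r y) ≡ indicator b * count r
count-guard true  r = sym (+-identityʳ (count r))
count-guard {k} false r = count-false {k} {λ _ → false} λ _ → refl

count-*ʳ : (p : Fin k → Bool) (v : ℕ) → count p * v ≡ sum (λ x → indicator (p x) * v)
count-*ʳ p v = *-distribʳ-sum v (indicator ∘ p)

double-count : (p : Fin k → Bool) (r : Fin l → Bool) (E : Fin k → Fin l → Bool) →
  sum (λ x → indicator (p x) * count (λ y → E x y ∧ r y)) ≡
  sum (λ y → indicator (r y) * count (λ x → E x y ∧ p x))
double-count p r E = begin
    sum (λ x → indicator (p x) * count (λ y → E x y ∧ r y))
  ≡⟨ sum-cong-≗ (λ x → sym (count-guard (p x) (λ y → E x y ∧ r y))) ⟩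
    sum (λ x → count (λ y → p x ∧ (E x y ∧ r y)))
  ≡⟨ ∑-comm (λ x y → indicator (p x ∧ (E x y ∧ r y))) ⟩
    sum (λ y → count (λ x → p x ∧ (E x y ∧ r y)))
  ≡⟨ sum-cong-≗ (λ y → count-cong {p = λ x → p x ∧ (E x y ∧ r y)} λ x → swap (p x) (E x y) (r y)) ⟩
    sum (λ y → count (λ x → r y ∧ (E x y ∧ p x)))
  ≡⟨ sum-cong-≗ (λ y → count-guard (r y) (λ x → E x y ∧ p x)) ⟩
    sum (λ y → indicator (r y) * count (λ x → E x y ∧ p x))
  ∎
  where
  open ≡-Reasoning
  swap : ∀ a e b → a ∧ (e ∧ b) ≡ b ∧ (e ∧ a)
  swap true  true  true  = refl
  swap true  true  false = refl
  swap true  false b     = sym (∧-zeroʳ b)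
  swap false e     b     = sym (trans (cong (b ∧_) (∧-zeroʳ e)) (∧-zeroʳ b))

∑-guarded-mono : {f g : Fin k → ℕ} → (∀ x → p x ≡ true → f x ≤ g x) →
  sum (λ x → indicator (p x) * f x) ≤ sum (λ x → indicator (p x) * g x)
∑-guarded-mono {p = p} f≤g = sum-mono λ x → guarded (p x) (f≤g x)
  where
  guarded : ∀ {u v} a → (a ≡ true → u ≤ v) → indicator a * u ≤ indicator a * v
  guarded true  u≤v = +-monoˡ-≤ 0 (u≤v refl)
  guarded false _   = z≤n

∑-guarded-const : {f : Fin k → ℕ} {v : ℕ} → (∀ x → p x ≡ true → f x ≡ v) →
  sum (λ x → indicator (p x) * f x) ≡ count p * v
∑-guarded-const {p = p} f≡v =
  trans (≤-antisym (∑-guarded-mono (λ x → ≤-reflexive ∘ f≡v x))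
                   (∑-guarded-mono (λ x → ≤-reflexive ∘ sym ∘ f≡v x)))
        (sym (count-*ʳ p _))

count-single : (x : Fin k) → count (λ y → y == x) ≡ 1
count-single x = count≡1 x (==-refl x) (λ y → ==⇒≡)

indicator*2≤ : ∀ a v → indicator a * 2 ≤
  2 * indicator (a ∧ (v ≡ᵇ 0)) + indicator (a ∧ (v ≡ᵇ 1)) + indicator a * v
indicator*2≤ false v             = z≤n
indicator*2≤ true  zero          = ≤-refl
indicator*2≤ true  (suc zero)    = ≤-refl
indicator*2≤ true  (suc (suc v)) = s≤s (s≤s z≤n)

length-filterᵇ-tabulate : (p : A → Bool) (f : Fin k → A) →
  length (filterᵇ p (tabulate f)) ≡ count (p ∘ f)
length-filterᵇ-tabulate {k = zero}  p f = refl
length-filterᵇ-tabulate {k = suc k} p f with p (f zero)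
... | true  = cong suc (length-filterᵇ-tabulate p (f ∘ suc))
... | false = length-filterᵇ-tabulate p (f ∘ suc)

any-true : (p : A → Bool) {x : A} {xs : List A} → x ∈ xs → p x ≡ true → any p xs ≡ true
any-true p x∈xs px = Equivalence.to T-≡ (any⁺ p (lose x∈xs (Equivalence.from T-≡ px)))

any-false : (p : A → Bool) (xs : List A) → (∀ x → p x ≡ false) → any p xs ≡ false
any-false p []       _  = refl
any-false p (x ∷ xs) p≗false rewrite p≗false x = any-false p xs p≗false

-- Reachability and distance in the incidence graph

module _ {n m : ℕ} (inc : Incidence n m) where

  private variable
    i j : ℕ
    u v : Vertex inc

  reach-suc : reach inc j u v ≡ true → reach inc (suc j) u v ≡ true
  reach-suc h rewrite h = refl

  reach-mono : i ≤ j → reach inc i u v ≡ true → reach inc j u v ≡ true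
  reach-mono {j = zero}  z≤n   h = h
  reach-mono {j = suc j} {u} {v} i≤1+j h with m≤n⇒m<n∨m≡n i≤1+j
  ... | inj₂ refl  = h
  ... | inj₁ i<1+j = reach-suc {j} {u} {v} (reach-mono (≤-pred i<1+j) h)

  search-≤ : ∀ i f → reach inc j u v ≡ true → i ≤ j → j ≤ i + f → distSearch inc i f u v ≤ j
  search-≤ i zero    _ i≤j _ = i≤j
  search-≤ {j} {u} {v} i (suc f) h i≤j j≤i+1+f with reach inc i u v in e
  ... | true  = i≤j
  ... | false = search-≤ (suc i) f h (≤∧≢⇒< i≤j i≢j) (subst (j ≤_) (+-suc i f) j≤i+1+f)
    where
    i≢j : i ≢ j
    i≢j refl with () ← trans (sym e) h

  search-> : ∀ i f → reach inc j u v ≡ false → j < i + f → j < distSearch inc i f u v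
  search-> i zero    _ j<i = subst (_ <_) (+-identityʳ i) j<i
  search-> {j} {u} {v} i (suc f) h j<i+1+f with reach inc i u v in e
  ... | true  = ≰⇒> λ i≤j → case trans (sym (reach-mono i≤j e)) h of λ ()
  ... | false = search-> (suc i) f h (subst (j <_) (+-suc i f) j<i+1+f)

  dist-≤ : reach inc j u v ≡ true → j ≤ n + m → dist inc u v ≤ j
  dist-≤ h j≤n+m = search-≤ 0 (n + m) h z≤n j≤n+m

  dist-> : reach inc j u v ≡ false → j < n + m → j < dist inc u v
  dist-> h j<n+m = search-> 0 (n + m) h j<n+m

  point∈vertices : (X : Fin n) → inj₁ X ∈ vertices inc
  point∈vertices X = ∈-++⁺ˡ (∈-map⁺ inj₁ (∈-allFin X))

  circle∈vertices : (c : Fin m) → inj₂ c ∈ vertices inc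
  circle∈vertices c = ∈-++⁺ʳ (map inj₁ (allFin n)) (∈-map⁺ inj₂ (∈-allFin c))

  reach₁-circle-point : (c : Fin m) (X : Fin n) → reach inc 1 (inj₂ c) (inj₁ X) ≡ inc X c
  reach₁-circle-point c X with inc X c in X∈c
  ... | true  = any-true _ (circle∈vertices c) (subst (λ b → (b ∧ inc X c) ≡ true) (sym (==-refl c)) X∈c)
  ... | false = any-false _ (vertices inc) λ { (inj₁ Y) → refl ; (inj₂ z) → via z }
    where
    via : ∀ z → (c == z ∧ inc X z) ≡ false
    via z with c ≟ z
    ... | yes refl = X∈c
    ... | no _     = refl

  reach₁-circles : {c b : Fin m} → c ≢ b → reach inc 1 (inj₂ c) (inj₂ b) ≡ false
  reach₁-circles c≢b rewrite ≢⇒==-false c≢b = any-false _ (vertices inc) λ where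
    (inj₁ Y) → refl
    (inj₂ z) → ∧-zeroʳ _

  reach₂-circles : {c b : Fin m} → c ≢ b →
    reach inc 2 (inj₂ c) (inj₂ b) ≡ any (λ w → reach inc 1 (inj₂ c) w ∧ adj inc w (inj₂ b)) (vertices inc)
  reach₂-circles c≢b rewrite reach₁-circles c≢b = refl

  reach₂-meet : {c b : Fin m} {X : Fin n} → c ≢ b → On inc X c → On inc X b →
    reach inc 2 (inj₂ c) (inj₂ b) ≡ true
  reach₂-meet {c} {b} {X} c≢b X∈c X∈b = trans (reach₂-circles c≢b)
    (any-true _ (point∈vertices X) (subst (λ x → (x ∧ inc X b) ≡ true) (sym (trans (reach₁-circle-point c X) X∈c)) X∈b))

  reach₂-disjoint : {c b : Fin m} → c ≢ b → (∀ X → On inc X c → inc X b ≡ false) →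
    reach inc 2 (inj₂ c) (inj₂ b) ≡ false
  reach₂-disjoint {c} {b} c≢b disjoint = trans (reach₂-circles c≢b)
    (any-false _ (vertices inc) λ { (inj₁ X) → via X ; (inj₂ z) → ∧-zeroʳ _ })
    where
    via : ∀ X → (reach inc 1 (inj₂ c) (inj₁ X) ∧ inc X b) ≡ false
    via X rewrite reach₁-circle-point c X with inc X c in X∈c
    ... | true  = disjoint X X∈c
    ... | false = refl

  dist-circle-self : (a : Fin m) → dist inc (inj₂ a) (inj₂ a) ≡ 0
  dist-circle-self a = n≤0⇒n≡0 (dist-≤ {u = inj₂ a} (==-refl a) z≤n)

  module _ (2<n+m : 2 < n + m) where

    dist-circles-distinct : {a b : Fin m} → a ≢ b → 0 < dist inc (inj₂ a) (inj₂ b)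
    dist-circles-distinct a≢b = dist-> (≢⇒==-false a≢b) (<-trans ℕ.z<s 2<n+m)

    dist-circles-meet : {c a : Fin m} {X : Fin n} → c ≢ a → On inc X c → On inc X a →
      dist inc (inj₂ c) (inj₂ a) ≤ 2
    dist-circles-meet c≢a X∈c X∈a = dist-≤ (reach₂-meet c≢a X∈c X∈a) (<⇒≤ 2<n+m)

    dist-circles-disjoint : {c b : Fin m} → c ≢ b → (∀ X → On inc X c → inc X b ≡ false) →
      2 < dist inc (inj₂ c) (inj₂ b)
    dist-circles-disjoint c≢b disjoint = dist-> (reach₂-disjoint c≢b disjoint) 2<n+m

  distinguishes : Fin m → Fin m → Vertex inc → Bool
  distinguishes a b v = not ⌊ dist inc v (inj₂ a) ℕ.≟ dist inc v (inj₂ b) ⌋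

  distinguishes-intro : {a b : Fin m} (v : Vertex inc) → dist inc v (inj₂ a) ≢ dist inc v (inj₂ b) →
    distinguishes a b v ≡ true
  distinguishes-intro {a} {b} v d≢d with dist inc v (inj₂ a) ℕ.≟ dist inc v (inj₂ b)
  ... | yes d≡d = contradiction d≡d d≢d
  ... | no _    = refl

  distinguishes⇒ : {a b : Fin m} (v : Vertex inc) → distinguishes a b v ≡ true →
    dist inc v (inj₂ a) ≢ dist inc v (inj₂ b)
  distinguishes⇒ {a} {b} v h d≡d with dist inc v (inj₂ a) ℕ.≟ dist inc v (inj₂ b)
  ... | no d≢d = d≢d d≡d

  count-distinguishing≤hyperedge : (a b : Fin m) →
    count (λ c → distinguishes a b (inj₂ c)) ≤ length (hyperedge inc a b)
  count-distinguishing≤hyperedge a b = begin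
      count (λ c → h (inj₂ c))
    ≡⟨ length-filterᵇ-tabulate h inj₂ ⟨
      length (filterᵇ h (tabulate inj₂))
    ≡⟨ cong (length ∘ filterᵇ h) (map-tabulate id inj₂) ⟨
      length (filterᵇ h circles)
    ≤⟨ m≤n+m _ _ ⟩
      length (filterᵇ h points) + length (filterᵇ h circles)
    ≡⟨ length-++ (filterᵇ h points) ⟨
      length (filterᵇ h points ++ filterᵇ h circles)
    ≡⟨ cong length (filter-++ _ points circles) ⟨
      length (hyperedge inc a b)
    ∎
    where
    open ≤-Reasoning
    h = distinguishes a b
    points = map inj₁ (allFin n)
    circles = map inj₂ (allFin m)

-- Counting in a finite Möbius plane

module MobiusPlane {n m : ℕ} (inc : Incidence n m) (M : IsMobiusPlane inc)
                   (q : ℕ) (size : ∀ z → circleSize inc z ≡ suc q) where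
  open IsMobiusPlane M

  pointsOf : Fin m → Fin n → Bool
  pointsOf c X = inc X c

  circleSize≡count : (z : Fin m) → circleSize inc z ≡ count (pointsOf z)
  circleSize≡count z = length-filterᵇ-tabulate (pointsOf z) id

  points-on : (z : Fin m) → count (pointsOf z) ≡ suc q
  points-on z = trans (sym (circleSize≡count z)) (size z)

  2≤q : 2 ≤ q
  2≤q = ≤-pred (subst (3 ≤_) (size axiom3a) (axiom3b axiom3a))

  ∣_∩_∣ : Fin m → Fin m → ℕ
  ∣ c ∩ b ∣ = count (λ X → inc X c ∧ inc X b)

  circle-unique : ∀ {P Q R c c'} → P ≢ Q → P ≢ R → Q ≢ R →
    On inc P c → On inc Q c → On inc R c → On inc P c' → On inc Q c' → On inc R c' → c ≡ c'
  circle-unique P≢Q P≢R Q≢R P∈c Q∈c R∈c P∈c' Q∈c' R∈c' with axiom1 _ _ _ P≢Q P≢R Q≢R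
  ... | _ , _ , unique = trans (unique _ P∈c Q∈c R∈c) (sym (unique _ P∈c' Q∈c' R∈c'))

  ∣∩∣≤2 : ∀ {c c'} → c ≢ c' → ∣ c ∩ c' ∣ ≤ 2
  ∣∩∣≤2 c≢c' = count≤2 λ X Y Z hX hY hZ X≢Y X≢Z Y≢Z →
    let X∈c , X∈c' = ∧-elim hX ; Y∈c , Y∈c' = ∧-elim hY ; Z∈c , Z∈c' = ∧-elim hZ in
    c≢c' (circle-unique X≢Y X≢Z Y≢Z X∈c Y∈c Z∈c X∈c' Y∈c' Z∈c')

  circles-through-three : ∀ {P Q R} → P ≢ Q → P ≢ R → Q ≢ R →
    count (λ c → inc P c ∧ (inc Q c ∧ inc R c)) ≡ 1
  circles-through-three P≢Q P≢R Q≢R with axiom1 _ _ _ P≢Q P≢R Q≢R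
  ... | c , (P∈c , Q∈c , R∈c) , unique = count≡1 c (∧-intro P∈c (∧-intro Q∈c R∈c)) λ c' h →
    let P∈c' , QR∈c' = ∧-elim h ; Q∈c' , R∈c' = ∧-elim QR∈c' in unique c' P∈c' Q∈c' R∈c'

  third-point : ∀ z P Q → ∃ λ R → On inc R z × R ≢ P × R ≢ Q
  third-point z P Q with count>0⇒∃ {p = (pointsOf z without P) without Q} two<
    where
    two< : 0 < count ((pointsOf z without P) without Q)
    two< = ≤-pred (≤-pred (begin
      3                                                       ≤⟨ axiom3b z ⟩
      circleSize inc z                                        ≡⟨ circleSize≡count z ⟩
      count (pointsOf z)                                      ≤⟨ count-remove-≤ P ⟩
      suc (count (pointsOf z without P))                      ≤⟨ s≤s (count-remove-≤ Q) ⟩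
      suc (suc (count ((pointsOf z without P) without Q)))    ∎))
      where open ≤-Reasoning
  ... | R , h with without⇒ {p = pointsOf z without P} h
  ...   | h' , R≢Q with without⇒ {p = pointsOf z} h'
  ...     | R∈z , R≢P = R , R∈z , R≢P , R≢Q

  circle-avoiding : ∀ {P Q} → P ≢ Q → ∃ λ c → On inc Q c × inc P c ≡ false
  circle-avoiding {P} {Q} P≢Q with third-point axiom3a P Q
  ... | R , _ , R≢P , R≢Q with axiom1 P Q R P≢Q (R≢P ∘ sym) (R≢Q ∘ sym)
  ... | w , (P∈w , Q∈w , R∈w) , _ with axiom4 w
  ... | S , S∉w with axiom1 Q R S (R≢Q ∘ sym) (λ { refl → S∉w Q∈w }) (λ { refl → S∉w R∈w })
  ... | c , (Q∈c , R∈c , S∈c) , _ = c , Q∈c , ¬-not P∉c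
    where
    P∉c : ¬ On inc P c
    P∉c P∈c = S∉w (subst (On inc S) (circle-unique P≢Q (R≢P ∘ sym) (R≢Q ∘ sym) P∈c Q∈c R∈c P∈w Q∈w R∈w) S∈c)

  points-on-except : ∀ {P c} → On inc P c → count (pointsOf c without P) ≡ q
  points-on-except {P} {c} P∈c = suc-injective (trans (sym (count-remove P P∈c)) (points-on c))

  points-on-except-two : ∀ {P Q c} → On inc P c → On inc Q c → Q ≢ P →
    count ((pointsOf c without P) without Q) ≡ pred q
  points-on-except-two {P} {Q} {c} P∈c Q∈c Q≢P = cong pred (begin
    suc (count ((pointsOf c without P) without Q)) ≡⟨ count-remove Q (∧-intro Q∈c (cong not (≢⇒==-false Q≢P))) ⟨
    count (pointsOf c without P)                   ≡⟨ points-on-except P∈c ⟩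
    q                                              ∎)
    where open ≡-Reasoning

  -- Fix a circle c₀ through Q avoiding P.  Apart from the circle tangent to c₀ at Q,
  -- every circle through P and Q meets c₀ in exactly one more point, and every point
  -- of c₀ other than Q lies on exactly one circle through P and Q.
  module Pencil {P Q c₀} (P≢Q : P ≢ Q) (Q∈c₀ : On inc Q c₀) (P∉c₀ : inc P c₀ ≡ false) where

    rest : Fin n → Bool
    rest = pointsOf c₀ without Q

    rest⇒ : ∀ {X} → rest X ≡ true → On inc X c₀ × X ≢ Q
    rest⇒ = without⇒ {p = pointsOf c₀}

    through : Fin m → Bool
    through c = inc P c ∧ inc Q c

    tangent : Fin m → Bool
    tangent c = count (λ X → inc X c ∧ rest X) ≡ᵇ 0

    tangent⇒ : ∀ c → tangent c ≡ true → ∀ X → On inc X c₀ → On inc X c → X ≡ Q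
    tangent⇒ c t X X∈c₀ X∈c with X ≟ Q
    ... | yes X≡Q = X≡Q
    ... | no X≢Q  = contradiction (count≡0⇒false (≡ᵇ-true⇒≡ t) X) X∈c∧rest
      where
      X∈c∧rest : (inc X c ∧ rest X) ≢ false
      X∈c∧rest rewrite ≢⇒==-false X≢Q | X∈c₀ | X∈c = λ ()

    ⇒tangent : ∀ c → (∀ X → On inc X c₀ → On inc X c → X ≡ Q) → tangent c ≡ true
    ⇒tangent c touch = cong (_≡ᵇ 0) (count-false off)
      where
      off : ∀ X → (inc X c ∧ rest X) ≡ false
      off X with inc X c in X∈c | inc X c₀ in X∈c₀
      ... | false | _     = refl
      ... | true  | false = refl
      ... | true  | true rewrite touch X X∈c₀ X∈c | ==-refl Q = refl

    tangent-unique : count (λ c → through c ∧ tangent c) ≡ 1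
    tangent-unique with axiom2 c₀ Q P Q∈c₀ (not-¬ P∉c₀)
    ... | z , (Q∈z , P∈z , touch) , unique =
      count≡1 z (∧-intro (∧-intro P∈z Q∈z) (⇒tangent z touch)) λ c h →
        let PQ∈c , t = ∧-elim h ; P∈c , Q∈c = ∧-elim PQ∈c in
        unique c Q∈c P∈c (tangent⇒ c t)

    secant : Fin m → Bool
    secant c = through c ∧ not (tangent c)

    secant-meets-rest-once : ∀ c → secant c ≡ true → count (λ X → inc X c ∧ rest X) ≡ 1
    secant-meets-rest-once c h = ≤-antisym (count≤1 at-most-one) (≢ᵇ0⇒>0 (not≡true⇒≡false t))
      where
      PQ∈c = proj₁ (∧-elim h)
      t = proj₂ (∧-elim h)
      at-most-one : ∀ X Y → (inc X c ∧ rest X) ≡ true → (inc Y c ∧ rest Y) ≡ true → X ≡ Y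
      at-most-one X Y hX hY with X ≟ Y
      ... | yes X≡Y = X≡Y
      ... | no X≢Y =
        let X∈c , restX = ∧-elim hX ; X∈c₀ , X≢Q = rest⇒ restX
            Y∈c , restY = ∧-elim hY ; Y∈c₀ , Y≢Q = rest⇒ restY
            P∈c , Q∈c = ∧-elim PQ∈c
            c≡c₀ = circle-unique (X≢Q ∘ sym) (Y≢Q ∘ sym) X≢Y Q∈c X∈c Y∈c Q∈c₀ X∈c₀ Y∈c₀
        in contradiction (trans (sym (subst (On inc P) c≡c₀ P∈c)) P∉c₀) λ ()

    point-on-one-secant : ∀ X → rest X ≡ true → count (λ c → inc X c ∧ secant c) ≡ 1
    point-on-one-secant X restX =
      trans (count-cong same) (circles-through-three P≢Q P≢X (X≢Q ∘ sym))
      where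
      X∈c₀ = proj₁ (rest⇒ restX)
      X≢Q = proj₂ (rest⇒ restX)
      P≢X : P ≢ X
      P≢X refl = contradiction (trans (sym X∈c₀) P∉c₀) λ ()
      same : ∀ c → (inc X c ∧ secant c) ≡ (inc P c ∧ (inc Q c ∧ inc X c))
      same c with inc X c in X∈c | inc P c | inc Q c
      ... | false | P∈c   | Q∈c   = sym (trans (cong (P∈c ∧_) (∧-zeroʳ Q∈c)) (∧-zeroʳ P∈c))
      ... | true  | false | _     = refl
      ... | true  | true  | false = refl
      ... | true  | true  | true  rewrite >0⇒≢ᵇ0 (count-≥1 {p = λ Y → inc Y c ∧ rest Y} X (∧-intro X∈c restX)) = refl

    secant-count : count secant ≡ q
    secant-count = begin
      count secant                                                    ≡⟨ *-identityʳ _ ⟨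
      count secant * 1                                                ≡⟨ ∑-guarded-const secant-meets-rest-once ⟨
      sum (λ c → indicator (secant c) * count (λ X → inc X c ∧ rest X)) ≡⟨ double-count secant rest (λ c X → inc X c) ⟩
      sum (λ X → indicator (rest X) * count (λ c → inc X c ∧ secant c)) ≡⟨ ∑-guarded-const point-on-one-secant ⟩
      count rest * 1                                                  ≡⟨ *-identityʳ _ ⟩
      count rest                                                      ≡⟨ points-on-except Q∈c₀ ⟩
      q                                                               ∎
      where open ≡-Reasoning

  circles-through-two : ∀ {P Q} → P ≢ Q → count (λ c → inc P c ∧ inc Q c) ≡ suc q
  circles-through-two P≢Q with circle-avoiding P≢Q
  ... | c₀ , Q∈c₀ , P∉c₀ =
    trans (count-split through tangent) (cong₂ _+_ tangent-unique secant-count)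
    where open Pencil P≢Q Q∈c₀ P∉c₀

  points-except : ∀ P → count (λ X → not (X == P)) ≡ q * q
  points-except P with third-point axiom3a P P
  ... | Q , _ , Q≢P , _ = begin
    count (λ X → not (X == P))                                       ≡⟨ count-remove Q (cong not (≢⇒==-false Q≢P)) ⟩
    suc (count others)                                               ≡⟨ cong suc (*-identityʳ _) ⟨
    suc (count others * 1)                                           ≡⟨ cong suc (∑-guarded-const on-one-circle) ⟨
    suc (sum (λ X → indicator (others X) * count (λ c → inc X c ∧ through c)))
                                                                     ≡⟨ cong suc (double-count through others (λ c X → inc X c)) ⟨
    suc (sum (λ c → indicator (through c) * count (λ X → inc X c ∧ others X)))
                                                                     ≡⟨ cong suc (∑-guarded-const others-on) ⟩
    suc (count through * pred q)                                     ≡⟨ cong (λ t → suc (t * pred q)) (circles-through-two (Q≢P ∘ sym)) ⟩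
    suc (suc q * pred q)                                             ≡⟨ square q (<-trans (s≤s z≤n) 2≤q) ⟩
    q * q                                                            ∎
    where
    open ≡-Reasoning
    others : Fin n → Bool
    others = (λ X → not (X == P)) without Q
    through : Fin m → Bool
    through c = inc P c ∧ inc Q c
    on-one-circle : ∀ X → others X ≡ true → count (λ c → inc X c ∧ through c) ≡ 1
    on-one-circle X h with without⇒ {p = λ X → not (X == P)} h
    ... | X≠P , X≢Q = trans (count-cong λ c → trans (∧-comm (inc X c) _) (∧-assoc (inc P c) _ _))
                            (circles-through-three (Q≢P ∘ sym) (not-==⇒≢ X≠P ∘ sym) (X≢Q ∘ sym))
    others-on : ∀ c → through c ≡ true → count (λ X → inc X c ∧ others X) ≡ pred q
    others-on c h = let P∈c , Q∈c = ∧-elim h in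
      trans (count-cong λ X → sym (∧-assoc (inc X c) _ _)) (points-on-except-two P∈c Q∈c Q≢P)
    square : ∀ q → 0 < q → suc (suc q * pred q) ≡ q * q
    square (suc q) _ = expand q
      where
      expand : ∀ q → suc (suc (suc q) * q) ≡ suc q * suc q
      expand = solve-∀

  circles-through : ∀ P → count (inc P) ≡ q * suc q
  circles-through P = *-cancelʳ-≡ _ _ q {{>-nonZero (<-trans (s≤s z≤n) 2≤q)}} (begin
    count (inc P) * q                                                            ≡⟨ ∑-guarded-const {p = inc P} (λ c → points-on-except {P} {c}) ⟨
    sum (λ c → indicator (inc P c) * count (pointsOf c without P))             ≡⟨ double-count (inc P) (λ X → not (X == P)) (λ c X → inc X c) ⟩
    sum (λ X → indicator (not (X == P)) * count (λ c → inc X c ∧ inc P c))     ≡⟨ ∑-guarded-const through-P-and ⟩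
    count (λ X → not (X == P)) * suc q                                           ≡⟨ cong (_* suc q) (points-except P) ⟩
    q * q * suc q                                                                ≡⟨ reorder q ⟩
    q * suc q * q                                                                ∎)
    where
    open ≡-Reasoning
    through-P-and : ∀ X → not (X == P) ≡ true → count (λ c → inc X c ∧ inc P c) ≡ suc q
    through-P-and X X≠P = circles-through-two (not-==⇒≢ X≠P)
    reorder : ∀ q → q * q * suc q ≡ q * suc q * q
    reorder = solve-∀

  misses : Fin m → Fin m → Bool
  misses c b = ∣ c ∩ b ∣ ≡ᵇ 0

  intersections-through : ∀ {P b} → inc P b ≡ false →
    sum (λ c → indicator (inc P c) * ∣ c ∩ b ∣) ≡ suc q * suc q
  intersections-through {P} {b} P∉b = begin
    sum (λ c → indicator (inc P c) * ∣ c ∩ b ∣)                        ≡⟨ double-count (inc P) (pointsOf b) (λ c X → inc X c) ⟩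
    sum (λ X → indicator (inc X b) * count (λ c → inc X c ∧ inc P c)) ≡⟨ ∑-guarded-const through-P-and ⟩
    count (pointsOf b) * suc q                                          ≡⟨ cong (_* suc q) (points-on b) ⟩
    suc q * suc q                                                       ∎
    where
    open ≡-Reasoning
    through-P-and : ∀ X → On inc X b → count (λ c → inc X c ∧ inc P c) ≡ suc q
    through-P-and X X∈b = circles-through-two λ { refl → contradiction (trans (sym X∈b) P∉b) λ () }

  tangents-through : ∀ {P b} → inc P b ≡ false → count (λ c → inc P c ∧ (∣ c ∩ b ∣ ≡ᵇ 1)) ≤ suc q
  tangents-through {P} {b} P∉b = begin
    count tangent                                                       ≡⟨ *-identityʳ _ ⟨
    count tangent * 1                                                   ≡⟨ ∑-guarded-const {p = tangent} (λ c h → ≡ᵇ-true⇒≡ (proj₂ (∧-elim {inc P c} h))) ⟨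
    sum (λ c → indicator (tangent c) * ∣ c ∩ b ∣)                        ≡⟨ double-count tangent (pointsOf b) (λ c X → inc X c) ⟩
    sum (λ X → indicator (inc X b) * count (λ c → inc X c ∧ tangent c)) ≤⟨ ∑-guarded-mono one-tangent-at ⟩
    sum (λ X → indicator (inc X b) * 1)                                  ≡⟨ count-*ʳ (pointsOf b) 1 ⟨
    count (pointsOf b) * 1                                               ≡⟨ cong (_* 1) (points-on b) ⟩
    suc q * 1                                                            ≡⟨ *-identityʳ _ ⟩
    suc q                                                                ∎
    where
    open ≤-Reasoning
    tangent : Fin m → Bool
    tangent c = inc P c ∧ (∣ c ∩ b ∣ ≡ᵇ 1)
    one-tangent-at : ∀ X → On inc X b → count (λ c → inc X c ∧ tangent c) ≤ 1
    one-tangent-at X X∈b with axiom2 b X P X∈b (not-¬ P∉b)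
    ... | z , _ , unique = count≤1 λ c c' h h' → trans (is-z c h) (sym (is-z c' h'))
      where
      is-z : ∀ c → (inc X c ∧ tangent c) ≡ true → c ≡ z
      is-z c h = let X∈c , t = ∧-elim h ; P∈c , one = ∧-elim t in
        unique c X∈c P∈c λ Y Y∈b Y∈c →
          count≡1⇒unique (≡ᵇ-true⇒≡ one) Y X (∧-intro Y∈c Y∈b) (∧-intro X∈c X∈b)

  circles-missing-through : ∀ {P b} → inc P b ≡ false →
    2 * (q * suc q) ≤ 2 * count (λ c → inc P c ∧ misses c b) + suc q * suc (suc q)
  circles-missing-through {P} {b} P∉b = begin
    2 * (q * suc q)                          ≡⟨ cong (2 *_) (circles-through P) ⟨
    2 * count (inc P)                        ≡⟨ *-comm 2 (count (inc P)) ⟩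
    count (inc P) * 2                        ≡⟨ count-*ʳ (inc P) 2 ⟩
    sum (λ c → indicator (inc P c) * 2)      ≤⟨ sum-mono (λ c → indicator*2≤ (inc P c) ∣ c ∩ b ∣) ⟩
    sum (λ c → 2 * missing c + tangent c + meeting c)
      ≡⟨ ∑-distrib-+ (λ c → 2 * missing c + tangent c) meeting ⟩
    sum (λ c → 2 * missing c + tangent c) + sum meeting
      ≡⟨ cong (_+ sum meeting) (∑-distrib-+ (λ c → 2 * missing c) tangent) ⟩
    sum (λ c → 2 * missing c) + sum tangent + sum meeting
      ≡⟨ cong (λ t → t + sum tangent + sum meeting) (*-distribˡ-sum 2 missing) ⟨
    2 * sum missing + sum tangent + sum meeting
      ≤⟨ +-mono-≤ (+-monoʳ-≤ (2 * sum missing) (tangents-through P∉b)) (≤-reflexive (intersections-through P∉b)) ⟩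
    2 * sum missing + suc q + suc q * suc q  ≡⟨ +-assoc (2 * sum missing) (suc q) _ ⟩
    2 * sum missing + (suc q + suc q * suc q) ≡⟨ cong (2 * sum missing +_) (*-suc (suc q) (suc q)) ⟨
    2 * sum missing + suc q * suc (suc q)    ∎
    where
    open ≤-Reasoning
    missing tangent meeting : Fin m → ℕ
    missing c = indicator (inc P c ∧ misses c b)
    tangent c = indicator (inc P c ∧ (∣ c ∩ b ∣ ≡ᵇ 1))
    meeting c = indicator (inc P c) * ∣ c ∩ b ∣

  meets : Fin m → Fin m → Bool
  meets c a = not (misses c a)

  meetsOnly : Fin m → Fin m → Fin m → Bool
  meetsOnly a b c = (not (c == a) ∧ misses c b) ∧ meets c a

  _∖_ : Fin m → Fin m → Fin n → Bool
  (a ∖ b) X = inc X a ∧ not (inc X b)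

  q≤1+∣∖∣ : ∀ {a b} → a ≢ b → q ≤ suc (count (a ∖ b))
  q≤1+∣∖∣ {a} {b} a≢b = ≤-pred (begin
    suc q                          ≡⟨ points-on a ⟨
    count (pointsOf a)             ≡⟨ count-split (pointsOf a) (pointsOf b) ⟩
    ∣ a ∩ b ∣ + count (a ∖ b)      ≤⟨ +-monoˡ-≤ (count (a ∖ b)) (∣∩∣≤2 a≢b) ⟩
    2 + count (a ∖ b)              ∎)
    where open ≤-Reasoning

  meetsOnly-through : ∀ {a b P} → On inc P a → inc P b ≡ false →
    2 * (q * suc q) ≤ 2 * count (λ c → inc P c ∧ meetsOnly a b c) + (2 + suc q * suc (suc q))
  meetsOnly-through {a} {b} {P} P∈a P∉b = begin
    2 * (q * suc q)                                        ≤⟨ circles-missing-through P∉b ⟩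
    2 * count missing + suc q * suc (suc q)               ≤⟨ +-monoˡ-≤ _ (*-monoʳ-≤ 2 (≤-trans (count-remove-≤ a) (s≤s (count-mono other⇒meetsOnly)))) ⟩
    2 * suc (count (λ c → inc P c ∧ meetsOnly a b c)) + suc q * suc (suc q)
                                                           ≡⟨ regroup (count (λ c → inc P c ∧ meetsOnly a b c)) (suc q * suc (suc q)) ⟩
    2 * count (λ c → inc P c ∧ meetsOnly a b c) + (2 + suc q * suc (suc q)) ∎
    where
    open ≤-Reasoning
    missing : Fin m → Bool
    missing c = inc P c ∧ misses c b
    other⇒meetsOnly : ∀ c → (missing without a) c ≡ true → (inc P c ∧ meetsOnly a b c) ≡ true
    other⇒meetsOnly c h with without⇒ {p = missing} h
    ... | m , c≢a with ∧-elim {inc P c} m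
    ...   | P∈c , c-misses-b = ∧-intro P∈c (∧-intro (∧-intro (cong not (≢⇒==-false c≢a)) c-misses-b)
                                                  (cong not (>0⇒≢ᵇ0 (count-≥1 {p = λ X → inc X c ∧ inc X a} P (∧-intro P∈c P∈a)))))
    regroup : ∀ x y → 2 * suc x + y ≡ 2 * x + (2 + y)
    regroup = solve-∀

  -- Each point of a ∖ b lies on many circles meeting a but missing b, and each such
  -- circle is counted at most twice since it meets a in at most two points.
  count-meetsOnly : ∀ {a b} →
    count (a ∖ b) * (2 * (q * suc q)) ≤ 4 * count (meetsOnly a b) + count (a ∖ b) * (2 + suc q * suc (suc q))
  count-meetsOnly {a} {b} = begin
    count (a ∖ b) * K                                                  ≡⟨ count-*ʳ (a ∖ b) K ⟩
    sum (λ P → indicator ((a ∖ b) P) * K)                             ≤⟨ ∑-guarded-mono per-point ⟩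
    sum (λ P → indicator ((a ∖ b) P) * (2 * g P + L))                 ≡⟨ sum-cong-≗ (λ P → split (indicator ((a ∖ b) P)) (g P) L) ⟩
    sum (λ P → 2 * (indicator ((a ∖ b) P) * g P) + indicator ((a ∖ b) P) * L)
      ≡⟨ ∑-distrib-+ (λ P → 2 * (indicator ((a ∖ b) P) * g P)) (λ P → indicator ((a ∖ b) P) * L) ⟩
    sum (λ P → 2 * (indicator ((a ∖ b) P) * g P)) + sum (λ P → indicator ((a ∖ b) P) * L)
      ≡⟨ cong₂ _+_ (*-distribˡ-sum 2 (λ P → indicator ((a ∖ b) P) * g P)) (count-*ʳ (a ∖ b) L) ⟨
    2 * sum (λ P → indicator ((a ∖ b) P) * g P) + count (a ∖ b) * L
      ≡⟨ cong (λ t → 2 * t + count (a ∖ b) * L) (double-count (a ∖ b) (meetsOnly a b) (λ P c → inc P c)) ⟩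
    2 * sum (λ c → indicator (meetsOnly a b c) * count (λ P → inc P c ∧ (a ∖ b) P)) + count (a ∖ b) * L
      ≤⟨ +-monoˡ-≤ _ (*-monoʳ-≤ 2 (∑-guarded-mono per-circle)) ⟩
    2 * sum (λ c → indicator (meetsOnly a b c) * 2) + count (a ∖ b) * L
      ≡⟨ cong (λ t → 2 * t + count (a ∖ b) * L) (count-*ʳ (meetsOnly a b) 2) ⟨
    2 * (count (meetsOnly a b) * 2) + count (a ∖ b) * L
      ≡⟨ cong (_+ count (a ∖ b) * L) (double (count (meetsOnly a b))) ⟩
    4 * count (meetsOnly a b) + count (a ∖ b) * L                     ∎
    where
    open ≤-Reasoning
    K L : ℕ
    K = 2 * (q * suc q)
    L = 2 + suc q * suc (suc q)
    g : Fin n → ℕ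
    g P = count (λ c → inc P c ∧ meetsOnly a b c)
    per-point : ∀ P → (a ∖ b) P ≡ true → K ≤ 2 * g P + L
    per-point P h = let P∈a , P∉b = ∧-elim {inc P a} h in meetsOnly-through P∈a (not≡true⇒≡false P∉b)
    per-circle : ∀ c → meetsOnly a b c ≡ true → count (λ P → inc P c ∧ (a ∖ b) P) ≤ 2
    per-circle c h = ≤-trans (count-mono λ P h' → let P∈c , P∈a∖b = ∧-elim {inc P c} h' in
                                                  ∧-intro P∈c (proj₁ (∧-elim {inc P a} P∈a∖b)))
                             (∣∩∣≤2 (not-==⇒≢ (proj₁ (∧-elim (proj₁ (∧-elim {not (c == a) ∧ misses c b} h))))))
    split : ∀ x y z → x * (2 * y + z) ≡ 2 * (x * y) + x * z
    split = solve-∀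
    double : ∀ x → 2 * (x * 2) ≡ 4 * x
    double = solve-∀

  2<n+m : 2 < n + m
  2<n+m = begin
    3                           ≤⟨ axiom3b axiom3a ⟩
    circleSize inc axiom3a      ≡⟨ circleSize≡count axiom3a ⟩
    count (pointsOf axiom3a)    ≤⟨ count-mono {n} {r = λ _ → true} (λ _ _ → refl) ⟩
    count {n} (λ _ → true)      ≡⟨ count-true ⟩
    n                           ≤⟨ m≤m+n n m ⟩
    n + m                       ∎
    where open ≤-Reasoning

  misses-self : ∀ c → misses c c ≡ false
  misses-self c = cong (_≡ᵇ 0) (trans (count-cong λ X → ∧-idem (inc X c)) (points-on c))

  meetsOnly-excludes : ∀ {a b c} → meetsOnly a b c ≡ true → c ≢ a × c ≢ b
  meetsOnly-excludes {a} {b} {c} h =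
    let c≠a∧misses , _ = ∧-elim {not (c == a) ∧ misses c b} h
        c≠a , c-misses-b = ∧-elim {not (c == a)} c≠a∧misses
    in not-==⇒≢ c≠a , λ { refl → contradiction (trans (sym c-misses-b) (misses-self c)) λ () }

  meetsOnly⇒distinguishes : ∀ {a b c} → meetsOnly a b c ≡ true → distinguishes inc a b (inj₂ c) ≡ true
  meetsOnly⇒distinguishes {a} {b} {c} h with meetsOnly-excludes h | ∧-elim {not (c == a) ∧ misses c b} h
  ... | c≢a , c≢b | c≠a∧misses , c-meets-a
    with count>0⇒∃ {p = λ X → inc X c ∧ inc X a} (≢ᵇ0⇒>0 (not≡true⇒≡false c-meets-a))
  ... | X , X∈c∩a = distinguishes-intro inc (inj₂ c) λ eq →
    ≤⇒≯ (dist-circles-meet inc 2<n+m c≢a (proj₁ (∧-elim X∈c∩a)) (proj₂ (∧-elim X∈c∩a)))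
        (subst (2 <_) (sym eq) (dist-circles-disjoint inc 2<n+m c≢b disjoint))
    where
    c-misses-b = proj₂ (∧-elim {not (c == a)} c≠a∧misses)
    disjoint : ∀ Y → On inc Y c → inc Y b ≡ false
    disjoint Y Y∈c = subst (λ x → (x ∧ inc Y b) ≡ false) Y∈c (count≡0⇒false (≡ᵇ-true⇒≡ c-misses-b) Y)

  length-hyperedge-≥ : ∀ {a b} → a ≢ b →
    2 + (count (meetsOnly a b) + count (meetsOnly b a)) ≤ length (hyperedge inc a b)
  length-hyperedge-≥ {a} {b} a≢b = begin
    2 + (count (meetsOnly a b) + count (meetsOnly b a))
      ≡⟨ cong₂ _+_ (cong₂ _+_ (count-single a) (count-single b)) refl ⟨
    count (_== a) + count (_== b) + (count (meetsOnly a b) + count (meetsOnly b a))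
      ≡⟨ cong₂ _+_ (count-∨ ends-disjoint) (count-∨ meetsOnly-disjoint) ⟨
    count ends + count others
      ≡⟨ count-∨ ends-others-disjoint ⟨
    count (λ c → ends c ∨ others c)
      ≤⟨ count-mono distinguishing ⟩
    count (λ c → distinguishes inc a b (inj₂ c))
      ≤⟨ count-distinguishing≤hyperedge inc a b ⟩
    length (hyperedge inc a b) ∎
    where
    open ≤-Reasoning
    ends others : Fin m → Bool
    ends c = (c == a) ∨ (c == b)
    others c = meetsOnly a b c ∨ meetsOnly b a c

    ends-disjoint : ∀ c → c == a ≡ true → c == b ≡ true → ⊥
    ends-disjoint c c≡a c≡b = a≢b (trans (sym (==⇒≡ c≡a)) (==⇒≡ c≡b))

    meetsOnly-disjoint : ∀ c → meetsOnly a b c ≡ true → meetsOnly b a c ≡ true → ⊥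
    meetsOnly-disjoint c h h' = contradiction (trans (sym c-misses-b) (not≡true⇒≡false c-meets-b)) λ ()
      where
      c-misses-b = proj₂ (∧-elim {not (c == a)} (proj₁ (∧-elim {not (c == a) ∧ misses c b} h)))
      c-meets-b = proj₂ (∧-elim {not (c == b) ∧ misses c a} h')

    excluded : ∀ c → others c ≡ true → c ≢ a × c ≢ b
    excluded c h with ∨-elim h
    ... | inj₁ h' = meetsOnly-excludes h'
    ... | inj₂ h' = let c≢b , c≢a = meetsOnly-excludes h' in c≢a , c≢b

    ends-others-disjoint : ∀ c → ends c ≡ true → others c ≡ true → ⊥
    ends-others-disjoint c e o with ∨-elim e | excluded c o
    ... | inj₁ c≡a | c≢a , _ = c≢a (==⇒≡ c≡a)
    ... | inj₂ c≡b | _ , c≢b = c≢b (==⇒≡ c≡b)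

    distinguishing : ∀ c → (ends c ∨ others c) ≡ true → distinguishes inc a b (inj₂ c) ≡ true
    distinguishing c h with ∨-elim h
    distinguishing c h | inj₁ e with ∨-elim e
    ... | inj₁ c≡a with refl ← ==⇒≡ {x = c} {a} c≡a = distinguishes-intro inc (inj₂ a) λ eq →
          <⇒≢ (dist-circles-distinct inc 2<n+m a≢b) (trans (sym (dist-circle-self inc a)) eq)
    ... | inj₂ c≡b with refl ← ==⇒≡ {x = c} {b} c≡b = distinguishes-intro inc (inj₂ b) λ eq →
          <⇒≢ (dist-circles-distinct inc 2<n+m (a≢b ∘ sym)) (sym (trans eq (dist-circle-self inc b)))
    distinguishing c h | inj₂ o with ∨-elim o
    ... | inj₁ h' = meetsOnly⇒distinguishes h'
    ... | inj₂ h' = distinguishes-intro inc (inj₂ c) (distinguishes⇒ inc (inj₂ c) (meetsOnly⇒distinguishes h') ∘ sym)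

-- With q = r + 3 the hypothesis reads 4 A ≥ x (q² − q − 4), and x ≥ q − 1.
per-side-bound : ∀ r x A → suc (suc r) ≤ x →
  x * (2 * ((3 + r) * (4 + r))) ≤ 4 * A + x * (2 + (4 + r) * (5 + r)) →
  (2 + r) * (r * r + 5 * r + 2) ≤ 4 * A
per-side-bound r x A r+2≤x h = begin
  (2 + r) * d              ≤⟨ *-monoˡ-≤ d r+2≤x ⟩
  x * d                    ≤⟨ +-cancelˡ-≤ (x * L) (x * d) (4 * A) (begin
    x * L + x * d            ≡⟨ split x r ⟩
    x * (2 * ((3 + r) * (4 + r))) ≤⟨ h ⟩
    4 * A + x * L            ≡⟨ +-comm (4 * A) (x * L) ⟩
    x * L + 4 * A            ∎) ⟩
  4 * A                    ∎
  where
  open ≤-Reasoning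
  d L : ℕ
  d = r * r + 5 * r + 2
  L = 2 + (4 + r) * (5 + r)
  split : ∀ x r → x * (2 + (4 + r) * (5 + r)) + x * (r * r + 5 * r + 2) ≡ x * (2 * ((3 + r) * (4 + r)))
  split = solve-∀

hyperedge-arithmetic : ∀ q x y A B E → 2 ≤ q → q ≤ suc x → q ≤ suc y →
  x * (2 * (q * suc q)) ≤ 4 * A + x * (2 + suc q * suc (suc q)) →
  y * (2 * (q * suc q)) ≤ 4 * B + y * (2 + suc q * suc (suc q)) →
  2 + (A + B) ≤ E → q ^ 3 + 11 * q ≤ 2 * E + 6 * q ^ 2 + 2
hyperedge-arithmetic 1 x y A B E (s≤s ()) _ _ _ _ _
hyperedge-arithmetic 2 x y A B E _ _ _ _ _ E≥ =
  +-monoˡ-≤ 2 (+-monoˡ-≤ 24 (*-monoʳ-≤ 2 (≤-trans (m≤m+n 2 (A + B)) E≥)))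
hyperedge-arithmetic (suc (suc (suc r))) x y A B E _ (s≤s q≤x) (s≤s q≤y) hx hy E≥ = begin
  (3 + r) ^ 3 + 11 * (3 + r)             ≤⟨ m≤m+n _ _ ⟩
  (3 + r) ^ 3 + 11 * (3 + r) + (4 * r * r + 10 * r + 4) ≡⟨ expand r ⟩
  4 + c + 6 * (3 + r) ^ 2 + 2            ≤⟨ +-monoˡ-≤ 2 (+-monoˡ-≤ (6 * (3 + r) ^ 2) c+4≤2E) ⟩
  2 * E + 6 * (3 + r) ^ 2 + 2            ∎
  where
  open ≤-Reasoning
  c = (2 + r) * (r * r + 5 * r + 2)
  c+4≤2E : 4 + c ≤ 2 * E
  c+4≤2E = *-cancelˡ-≤ 2 (begin
    2 * (4 + c)                     ≡⟨ twice c ⟩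
    8 + c + c                       ≤⟨ +-mono-≤ (+-monoʳ-≤ 8 (per-side-bound r x A q≤x hx)) (per-side-bound r y B q≤y hy) ⟩
    8 + 4 * A + 4 * B               ≡⟨ regroup A B ⟩
    2 * (2 * (2 + (A + B)))         ≤⟨ *-monoʳ-≤ 2 (*-monoʳ-≤ 2 E≥) ⟩
    2 * (2 * E)                     ∎)
    where
    twice : ∀ c → 2 * (4 + c) ≡ 8 + c + c
    twice = solve-∀
    regroup : ∀ A B → 8 + 4 * A + 4 * B ≡ 2 * (2 * (2 + (A + B)))
    regroup = solve-∀
  -- The powers are written as the products q ^ 3 and q ^ 2 unfold to, which the solver accepts.
  expand : ∀ r → (3 + r) * ((3 + r) * ((3 + r) * 1)) + 11 * (3 + r) + (4 * r * r + 10 * r + 4) ≡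
                 4 + (2 + r) * (r * r + 5 * r + 2) + 6 * ((3 + r) * ((3 + r) * 1)) + 2
  expand = solve-∀

mainTheorem2 : (n m : ℕ) (inc : Incidence n m) → IsMobiusPlane inc →
    (q : ℕ) → (∀ (z : Fin m) → circleSize inc z ≡ suc q) →
    (a b : Fin m) → a ≢ b →
    q ^ 3 + 11 * q ≤ 2 * length (hyperedge inc a b) + 6 * q ^ 2 + 2
mainTheorem2 n m inc M q size a b a≢b =
  hyperedge-arithmetic q (count (a ∖ b)) (count (b ∖ a))
    (count (meetsOnly a b)) (count (meetsOnly b a)) (length (hyperedge inc a b))
    2≤q (q≤1+∣∖∣ a≢b) (q≤1+∣∖∣ (a≢b ∘ sym))
    count-meetsOnly count-meetsOnly (length-hyperedge-≥ a≢b)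
  where open MobiusPlane inc M q size
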